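{- Let $n$ be a positive integer. A complete set of representatives of the $\mathrm{SL}(2,\mathbb Z)$-conjugacy classes of hyperbolic elements of $\mathcal M_{n^2}$ whose fixed points are cusps is $$\left\{\pm\begin{pmatrix}a&b+ma\\0&d\end{pmatrix}:\ b=1,\ldots,h,\ \gcd(b,h)=1,\ m=1,\ldots,(d-a)/h,\ \text{where } h=\gcd(a,d)\right\},$$ where $a,d$ run over all integers with $ad=n^2$ and $0<a<d$.
   Context: $\mathcal M_{n^2}$ is the set of integer matrices $\begin{pmatrix}a&b\\c&d\end{pmatrix}$ with $ad-bc=n^2$ and $\gcd(a,b,c,d)=1$. An element is hyperbolic if it has two distinct fixed points in $\mathbb P^1(\mathbb R)$; its fixed points are cusps if they lie in $\mathbb P^1(\mathbb Q)$. -}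

module Defs where

open import Data.Nat as ℕ using (ℕ; _∸_)
open import Data.Nat.GCD as ℕG using ()
open import Data.Integer using (ℤ; +_; -_; _+_; _-_; _*_; 1ℤ; -1ℤ)
open import Data.Integer.GCD using (gcd)
open import Data.Product using (Σ; _×_; _,_; ∃-syntax)
open import Data.Sum using (_⊎_)
open import Relation.Nullary using (¬_)
open import Relation.Binary.PropositionalEquality using (_≡_)

record Mat2 : Set where
  constructor mat
  field
    a b c d : ℤ
open Mat2 public

det : Mat2 → ℤ
det M = a M * d M - b M * c M

_⊗_ : Mat2 → Mat2 → Mat2
M ⊗ N = mat (a M * a N + b M * c N) (a M * b N + b M * d N)
            (c M * a N + d M * c N) (c M * b N + d M * d N)

-- adjugate; equals the inverse for matrices of determinant 1
adj : Mat2 → Mat2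
adj M = mat (d M) (- b M) (- c M) (a M)

scale : ℤ → Mat2 → Mat2
scale s M = mat (s * a M) (s * b M) (s * c M) (s * d M)

InM : ℕ → Mat2 → Set
InM n M = det M ≡ + (n ℕ.* n)
        × gcd (gcd (a M) (b M)) (gcd (c M) (d M)) ≡ 1ℤ

-- points of P^1(Q): nonzero integer pairs (x , y) representing x/y,
-- identified up to proportionality
NonZeroPt : ℤ × ℤ → Set
NonZeroPt (x , y) = ¬ (x ≡ + 0 × y ≡ + 0)

SamePt : ℤ × ℤ → ℤ × ℤ → Set
SamePt (x , y) (x' , y') = x * y' ≡ x' * y

-- (x : y) is fixed by z ↦ (az+b)/(cz+d), i.e. M (x,y)ᵀ is proportional to (x,y)ᵀ
IsFixed : Mat2 → ℤ × ℤ → Set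
IsFixed M (x , y) = NonZeroPt (x , y)
  × (a M * x + b M * y) * y ≡ (c M * x + d M * y) * x

-- hyperbolic with both fixed points cusps: the fixed points in P^1(R)
-- are exactly two distinct points, both lying in P^1(Q)
HypCusp : Mat2 → Set
HypCusp M = Σ (ℤ × ℤ) λ v → Σ (ℤ × ℤ) λ w →
    IsFixed M v × IsFixed M w × ¬ SamePt v w
  × ((u : ℤ × ℤ) → IsFixed M u → SamePt u v ⊎ SamePt u w)

SL2 : Mat2 → Set
SL2 γ = det γ ≡ 1ℤ

Conj : Mat2 → Mat2 → Set
Conj M N = Σ Mat2 λ γ → SL2 γ × N ≡ (γ ⊗ M) ⊗ adj γ

-- the proposed representative set
-- ± ( a  b+ma ; 0  d ),  a d = n², 0 < a < d, h = gcd(a,d),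
-- 1 ≤ b ≤ h, gcd(b,h) = 1, 1 ≤ m ≤ (d-a)/h  (written m·h ≤ d-a; h ∣ d-a)
IsRep : ℕ → Mat2 → Set
IsRep n M = Σ ℤ λ s → Σ ℕ λ a' → Σ ℕ λ d' → Σ ℕ λ b' → Σ ℕ λ m →
    (s ≡ 1ℤ ⊎ s ≡ -1ℤ)
  × a' ℕ.* d' ≡ n ℕ.* n
  × 0 ℕ.< a' × a' ℕ.< d'
  × 1 ℕ.≤ b' × b' ℕ.≤ ℕG.gcd a' d' × ℕG.gcd b' (ℕG.gcd a' d') ≡ 1
  × 1 ℕ.≤ m × m ℕ.* ℕG.gcd a' d' ℕ.≤ d' ∸ a'
  × M ≡ scale s (mat (+ a') (+ (b' ℕ.+ m ℕ.* a')) (+ 0) (+ d'))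

module Submission where

-- A rational fixed point (x : y) of M, scaled to a primitive vector, is the
-- first column of some γ ∈ SL(2,ℤ), and γ⁻¹ M γ is upper triangular with
-- diagonal α, δ and α δ = n². A scalar or parabolic matrix does not have
-- exactly two fixed points, so α ≠ δ, and triangularising at the other fixed
-- point swaps the diagonal; up to a common sign it is therefore 0 < a < d.
-- Conjugating by translations (1 t ; 0 1) shifts the upper right entry by
-- multiples of d - a. With h = gcd(a,d), a = α h and d - a = e h where α and e
-- are coprime, so every class modulo d - a has exactly one representative
-- b + m a with 1 ≤ b ≤ h and 1 ≤ m ≤ e; primitivity of M gives gcd(b,h) = 1.
-- Conversely, conjugate representatives have equal trace, hence equal
-- diagonals, and a conjugator between them must be ± a translation.

open import Defs
open import Data.Nat using (ℕ; _≤_)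
open import Data.Product using (Σ; _×_)
open import Relation.Binary.PropositionalEquality using (_≡_)

open import Data.Nat as ℕ using (suc; _<_; s≤s; z≤n; NonZero)
import Data.Nat.Properties as ℕₚ
import Data.Nat.Divisibility as ℕ
import Data.Nat.GCD as ℕ
import Data.Nat.Coprimality as ℕ
open import Data.Integer as ℤ
  using (ℤ; _+_; _*_; -_; _-_; 0ℤ; 1ℤ; -1ℤ; +_; -[1+_]; ∣_∣)
import Data.Integer.Properties as ℤₚ
import Data.Integer.Divisibility.Signed as ℤᵈ
import Data.Integer.Coprimality as ℤ
open import Data.Integer.DivMod using (_%ℕ_; _/ℕ_; a≡a%ℕn+[a/ℕn]*n; n%ℕd<d)
open import Data.Integer.Solver using (module +-*-Solver)
open import Data.Product using (_,_; proj₁; proj₂)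
open import Data.Sum using (_⊎_; inj₁; inj₂; [_,_])
open import Function using (_∘_)
open import Data.Vec.N-ary using (N-ary)
open import Data.Empty using (⊥-elim)
open import Relation.Nullary using (¬_; yes; no)
open import Relation.Binary.Definitions using (Tri; tri<; tri≈; tri>)
open import Relation.Binary.PropositionalEquality
  using (refl; sym; trans; cong; cong₂; subst; subst₂; module ≡-Reasoning)

IsSign : ℤ → Set
IsSign s = s ≡ 1ℤ ⊎ s ≡ -1ℤ

sign*sign≡1 : ∀ {s} → IsSign s → s * s ≡ 1ℤ
sign*sign≡1 (inj₁ refl) = refl
sign*sign≡1 (inj₂ refl) = refl

sign≢0 : ∀ {s} → IsSign s → ¬ s ≡ 0ℤ
sign≢0 (inj₁ refl) ()
sign≢0 (inj₂ refl) ()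

∣sign∣≡1 : ∀ {s} → IsSign s → ∣ s ∣ ≡ 1
∣sign∣≡1 (inj₁ refl) = refl
∣sign∣≡1 (inj₂ refl) = refl

∣sign*i∣≡∣i∣ : ∀ {s} → IsSign s → ∀ i → ∣ s * i ∣ ≡ ∣ i ∣
∣sign*i∣≡∣i∣ {s} σ i = trans (ℤₚ.abs-* s i) (trans (cong (ℕ._* ∣ i ∣) (∣sign∣≡1 σ)) (ℕₚ.*-identityˡ ∣ i ∣))

sign*[sign*i]≡i : ∀ {s} → IsSign s → ∀ i → s * (s * i) ≡ i
sign*[sign*i]≡i {s} σ i = trans (sym (ℤₚ.*-assoc s s i)) (trans (cong (_* i) (sign*sign≡1 σ)) (ℤₚ.*-identityˡ i))

i*j≡1⇒sign : ∀ i j → i * j ≡ 1ℤ → IsSign i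
i*j≡1⇒sign i j ij≡1 = unit i (ℕₚ.m*n≡1⇒m≡1 ∣ i ∣ ∣ j ∣ (trans (sym (ℤₚ.abs-* i j)) (cong ∣_∣ ij≡1)))
  where
  unit : ∀ i → ∣ i ∣ ≡ 1 → IsSign i
  unit (+ 1)    _ = inj₁ refl
  unit -[1+ 0 ] _ = inj₂ refl
  unit (+ 0) ()
  unit (+ suc (suc _)) ()
  unit -[1+ suc _ ] ()

sign*+-injective : ∀ {s s′ m m′} → IsSign s → IsSign s′ → 0 < m → 0 < m′ →
                   s * + m ≡ s′ * + m′ → s ≡ s′ × m ≡ m′
sign*+-injective {m = m} {m′} (inj₁ refl) (inj₁ refl) _ _ eq =
  refl , ℤₚ.+-injective (trans (sym (ℤₚ.*-identityˡ (+ m))) (trans eq (ℤₚ.*-identityˡ (+ m′))))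
sign*+-injective {m = m} {m′} (inj₂ refl) (inj₂ refl) _ _ eq =
  refl , ℤₚ.+-injective (ℤₚ.neg-injective (trans (sym (ℤₚ.-1*i≡-i (+ m))) (trans eq (ℤₚ.-1*i≡-i (+ m′)))))
sign*+-injective {m = suc m} {suc m′} (inj₁ refl) (inj₂ refl) _ _ eq
  with () ← trans (sym (ℤₚ.*-identityˡ (+ suc m))) (trans eq (ℤₚ.-1*i≡-i (+ suc m′)))
sign*+-injective {m = suc m} {suc m′} (inj₂ refl) (inj₁ refl) _ _ eq
  with () ← trans (sym (ℤₚ.-1*i≡-i (+ suc m))) (trans eq (ℤₚ.*-identityˡ (+ suc m′)))

*-cancelˡ-≢0 : ∀ {k i j} → ¬ k ≡ 0ℤ → k * i ≡ k * j → i ≡ j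
*-cancelˡ-≢0 {k} {i} {j} k≢0 = ℤₚ.*-cancelˡ-≡ k i j {{ℤ.≢-nonZero k≢0}}

k*i≡0⇒i≡0 : ∀ {k i} → ¬ k ≡ 0ℤ → k * i ≡ 0ℤ → i ≡ 0ℤ
k*i≡0⇒i≡0 {k} {i} k≢0 eq = *-cancelˡ-≢0 k≢0 (trans eq (sym (ℤₚ.*-zeroʳ k)))

i*i≡0⇒i≡0 : ∀ {i} → i * i ≡ 0ℤ → i ≡ 0ℤ
i*i≡0⇒i≡0 {i} eq with ℤₚ.i*j≡0⇒i≡0∨j≡0 i eq
... | inj₁ i≡0 = i≡0
... | inj₂ i≡0 = i≡0

conjugate : Mat2 → Mat2 → Mat2
conjugate γ M = (γ ⊗ M) ⊗ adj γ

act : Mat2 → ℤ × ℤ → ℤ × ℤ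
act M (x , y) = a M * x + b M * y , c M * x + d M * y

cross : ℤ × ℤ → ℤ × ℤ → ℤ
cross (x , y) (x′ , y′) = x * y′ - x′ * y

defect : Mat2 → ℤ × ℤ → ℤ
defect M u = cross (act M u) u

mat-≡ : ∀ {a₁ b₁ c₁ d₁ a₂ b₂ c₂ d₂} → a₁ ≡ a₂ → b₁ ≡ b₂ → c₁ ≡ c₂ → d₁ ≡ d₂ →
        mat a₁ b₁ c₁ d₁ ≡ mat a₂ b₂ c₂ d₂
mat-≡ refl refl refl refl = refl

det-upper-triangular : ∀ α β δ → det (mat α β 0ℤ δ) ≡ α * δ
det-upper-triangular α β δ = trans (cong (λ z → α * δ - z) (ℤₚ.*-zeroʳ β)) (ℤₚ.+-identityʳ (α * δ))

upper-triangular-≡ : ∀ N → c N ≡ 0ℤ → N ≡ mat (a N) (b N) 0ℤ (d N)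
upper-triangular-≡ _ c≡0 = mat-≡ refl refl c≡0 refl

-- Each identity below is an entrywise polynomial identity, checked by the ring
-- solver on matrices whose entries are solver polynomials.
module _ where
  open +-*-Solver

  record Matᴾ (n : ℕ) : Set where
    constructor matᴾ
    field aᴾ bᴾ cᴾ dᴾ : Polynomial n
  open Matᴾ

  _⊗ᴾ_ : ∀ {n} → Matᴾ n → Matᴾ n → Matᴾ n
  M ⊗ᴾ N = matᴾ (aᴾ M :* aᴾ N :+ bᴾ M :* cᴾ N) (aᴾ M :* bᴾ N :+ bᴾ M :* dᴾ N)
                (cᴾ M :* aᴾ N :+ dᴾ M :* cᴾ N) (cᴾ M :* bᴾ N :+ dᴾ M :* dᴾ N)

  adjᴾ : ∀ {n} → Matᴾ n → Matᴾ n
  adjᴾ M = matᴾ (dᴾ M) (:- bᴾ M) (:- cᴾ M) (aᴾ M)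

  detᴾ : ∀ {n} → Matᴾ n → Polynomial n
  detᴾ M = aᴾ M :* dᴾ M :- bᴾ M :* cᴾ M

  conjugateᴾ : ∀ {n} → Matᴾ n → Matᴾ n → Matᴾ n
  conjugateᴾ G M = (G ⊗ᴾ M) ⊗ᴾ adjᴾ G

  scaleᴾ : ∀ {n} → Polynomial n → Matᴾ n → Matᴾ n
  scaleᴾ k M = matᴾ (k :* aᴾ M) (k :* bᴾ M) (k :* cᴾ M) (k :* dᴾ M)

  defectᴾ : ∀ {n} → Matᴾ n → Polynomial n → Polynomial n → Polynomial n
  defectᴾ M x y = (aᴾ M :* x :+ bᴾ M :* y) :* y :- x :* (cᴾ M :* x :+ dᴾ M :* y)

  onMat² : (Matᴾ 8 → Matᴾ 8 → Polynomial 8 × Polynomial 8) → N-ary 8 (Polynomial 8) (Polynomial 8 × Polynomial 8)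
  onMat² f g₁ g₂ g₃ g₄ h₁ h₂ h₃ h₄ = f (matᴾ g₁ g₂ g₃ g₄) (matᴾ h₁ h₂ h₃ h₄)

  onMat³ : (Matᴾ 12 → Matᴾ 12 → Matᴾ 12 → Polynomial 12 × Polynomial 12) →
           N-ary 12 (Polynomial 12) (Polynomial 12 × Polynomial 12)
  onMat³ f g₁ g₂ g₃ g₄ h₁ h₂ h₃ h₄ m₁ m₂ m₃ m₄ = f (matᴾ g₁ g₂ g₃ g₄) (matᴾ h₁ h₂ h₃ h₄) (matᴾ m₁ m₂ m₃ m₄)

  det-⊗ : ∀ G H → det (G ⊗ H) ≡ det G * det H
  det-⊗ (mat g₁ g₂ g₃ g₄) (mat h₁ h₂ h₃ h₄) =
    solve 8 (onMat² λ G H → detᴾ (G ⊗ᴾ H) := detᴾ G :* detᴾ H) refl g₁ g₂ g₃ g₄ h₁ h₂ h₃ h₄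

  det-adj : ∀ G → det (adj G) ≡ det G
  det-adj (mat g₁ g₂ g₃ g₄) =
    solve 4 (λ g₁ g₂ g₃ g₄ → detᴾ (adjᴾ (matᴾ g₁ g₂ g₃ g₄)) := detᴾ (matᴾ g₁ g₂ g₃ g₄)) refl g₁ g₂ g₃ g₄

  det-scale : ∀ k M → det (scale k M) ≡ (k * k) * det M
  det-scale k (mat m₁ m₂ m₃ m₄) = solve 5 (λ k m₁ m₂ m₃ m₄ → let M = matᴾ m₁ m₂ m₃ m₄ in
    detᴾ (scaleᴾ k M) := (k :* k) :* detᴾ M) refl k m₁ m₂ m₃ m₄

  det-conjugate : ∀ G M → det (conjugate G M) ≡ (det G * det G) * det M
  det-conjugate (mat g₁ g₂ g₃ g₄) (mat m₁ m₂ m₃ m₄) =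
    solve 8 (onMat² λ G M → detᴾ (conjugateᴾ G M) := (detᴾ G :* detᴾ G) :* detᴾ M) refl g₁ g₂ g₃ g₄ m₁ m₂ m₃ m₄

  trace-conjugate : ∀ G M → a (conjugate G M) + d (conjugate G M) ≡ det G * (a M + d M)
  trace-conjugate (mat g₁ g₂ g₃ g₄) (mat m₁ m₂ m₃ m₄) =
    solve 8 (onMat² λ G M → aᴾ (conjugateᴾ G M) :+ dᴾ (conjugateᴾ G M) := detᴾ G :* (aᴾ M :+ dᴾ M))
      refl g₁ g₂ g₃ g₄ m₁ m₂ m₃ m₄

  conjugate-conjugate : ∀ G H M → conjugate G (conjugate H M) ≡ conjugate (G ⊗ H) M
  conjugate-conjugate (mat g₁ g₂ g₃ g₄) (mat h₁ h₂ h₃ h₄) (mat m₁ m₂ m₃ m₄) = mat-≡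
    (solve 12 (onMat³ λ G H M → aᴾ (conjugateᴾ G (conjugateᴾ H M)) := aᴾ (conjugateᴾ (G ⊗ᴾ H) M))
      refl g₁ g₂ g₃ g₄ h₁ h₂ h₃ h₄ m₁ m₂ m₃ m₄)
    (solve 12 (onMat³ λ G H M → bᴾ (conjugateᴾ G (conjugateᴾ H M)) := bᴾ (conjugateᴾ (G ⊗ᴾ H) M))
      refl g₁ g₂ g₃ g₄ h₁ h₂ h₃ h₄ m₁ m₂ m₃ m₄)
    (solve 12 (onMat³ λ G H M → cᴾ (conjugateᴾ G (conjugateᴾ H M)) := cᴾ (conjugateᴾ (G ⊗ᴾ H) M))
      refl g₁ g₂ g₃ g₄ h₁ h₂ h₃ h₄ m₁ m₂ m₃ m₄)
    (solve 12 (onMat³ λ G H M → dᴾ (conjugateᴾ G (conjugateᴾ H M)) := dᴾ (conjugateᴾ (G ⊗ᴾ H) M))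
      refl g₁ g₂ g₃ g₄ h₁ h₂ h₃ h₄ m₁ m₂ m₃ m₄)

  conjugate-adj-conjugate : ∀ G M → conjugate G ((adj G ⊗ M) ⊗ G) ≡ scale (det G * det G) M
  conjugate-adj-conjugate (mat g₁ g₂ g₃ g₄) (mat m₁ m₂ m₃ m₄) = mat-≡
    (solve 8 (onMat² λ G M → aᴾ (conjugateᴾ G ((adjᴾ G ⊗ᴾ M) ⊗ᴾ G)) := aᴾ (scaleᴾ (detᴾ G :* detᴾ G) M))
      refl g₁ g₂ g₃ g₄ m₁ m₂ m₃ m₄)
    (solve 8 (onMat² λ G M → bᴾ (conjugateᴾ G ((adjᴾ G ⊗ᴾ M) ⊗ᴾ G)) := bᴾ (scaleᴾ (detᴾ G :* detᴾ G) M))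
      refl g₁ g₂ g₃ g₄ m₁ m₂ m₃ m₄)
    (solve 8 (onMat² λ G M → cᴾ (conjugateᴾ G ((adjᴾ G ⊗ᴾ M) ⊗ᴾ G)) := cᴾ (scaleᴾ (detᴾ G :* detᴾ G) M))
      refl g₁ g₂ g₃ g₄ m₁ m₂ m₃ m₄)
    (solve 8 (onMat² λ G M → dᴾ (conjugateᴾ G ((adjᴾ G ⊗ᴾ M) ⊗ᴾ G)) := dᴾ (scaleᴾ (detᴾ G :* detᴾ G) M))
      refl g₁ g₂ g₃ g₄ m₁ m₂ m₃ m₄)

  conjugate-⊗ : ∀ G M → conjugate G M ⊗ G ≡ scale (det G) (G ⊗ M)
  conjugate-⊗ (mat g₁ g₂ g₃ g₄) (mat m₁ m₂ m₃ m₄) = mat-≡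
    (solve 8 (onMat² λ G M → aᴾ (conjugateᴾ G M ⊗ᴾ G) := aᴾ (scaleᴾ (detᴾ G) (G ⊗ᴾ M))) refl g₁ g₂ g₃ g₄ m₁ m₂ m₃ m₄)
    (solve 8 (onMat² λ G M → bᴾ (conjugateᴾ G M ⊗ᴾ G) := bᴾ (scaleᴾ (detᴾ G) (G ⊗ᴾ M))) refl g₁ g₂ g₃ g₄ m₁ m₂ m₃ m₄)
    (solve 8 (onMat² λ G M → cᴾ (conjugateᴾ G M ⊗ᴾ G) := cᴾ (scaleᴾ (detᴾ G) (G ⊗ᴾ M))) refl g₁ g₂ g₃ g₄ m₁ m₂ m₃ m₄)
    (solve 8 (onMat² λ G M → dᴾ (conjugateᴾ G M ⊗ᴾ G) := dᴾ (scaleᴾ (detᴾ G) (G ⊗ᴾ M))) refl g₁ g₂ g₃ g₄ m₁ m₂ m₃ m₄)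

  conjugate-translation : ∀ t s A X D →
    conjugate (mat 1ℤ t 0ℤ 1ℤ) (scale s (mat A X 0ℤ D)) ≡ scale s (mat A (X + t * (D - A)) 0ℤ D)
  conjugate-translation t s A X D = mat-≡
    (solve 5 (λ t s A X D → let T = matᴾ (con 1ℤ) t (con 0ℤ) (con 1ℤ) in
      aᴾ (conjugateᴾ T (scaleᴾ s (matᴾ A X (con 0ℤ) D))) := s :* A) refl t s A X D)
    (solve 5 (λ t s A X D → let T = matᴾ (con 1ℤ) t (con 0ℤ) (con 1ℤ) in
      bᴾ (conjugateᴾ T (scaleᴾ s (matᴾ A X (con 0ℤ) D))) := s :* (X :+ t :* (D :- A))) refl t s A X D)
    (solve 5 (λ t s A X D → let T = matᴾ (con 1ℤ) t (con 0ℤ) (con 1ℤ) in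
      cᴾ (conjugateᴾ T (scaleᴾ s (matᴾ A X (con 0ℤ) D))) := s :* con 0ℤ) refl t s A X D)
    (solve 5 (λ t s A X D → let T = matᴾ (con 1ℤ) t (con 0ℤ) (con 1ℤ) in
      dᴾ (conjugateᴾ T (scaleᴾ s (matᴾ A X (con 0ℤ) D))) := s :* D) refl t s A X D)

  act-adj-act : ∀ G u → act (adj G) (act G u) ≡ (det G * proj₁ u , det G * proj₂ u)
  act-adj-act (mat g₁ g₂ g₃ g₄) (x , y) = cong₂ _,_
    (solve 6 (λ g₁ g₂ g₃ g₄ x y → g₄ :* (g₁ :* x :+ g₂ :* y) :+ (:- g₂) :* (g₃ :* x :+ g₄ :* y)
      := detᴾ (matᴾ g₁ g₂ g₃ g₄) :* x) refl g₁ g₂ g₃ g₄ x y)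
    (solve 6 (λ g₁ g₂ g₃ g₄ x y → (:- g₃) :* (g₁ :* x :+ g₂ :* y) :+ g₁ :* (g₃ :* x :+ g₄ :* y)
      := detᴾ (matᴾ g₁ g₂ g₃ g₄) :* y) refl g₁ g₂ g₃ g₄ x y)

  act-act-adj : ∀ G u → act G (act (adj G) u) ≡ (det G * proj₁ u , det G * proj₂ u)
  act-act-adj (mat g₁ g₂ g₃ g₄) (x , y) = cong₂ _,_
    (solve 6 (λ g₁ g₂ g₃ g₄ x y → g₁ :* (g₄ :* x :+ (:- g₂) :* y) :+ g₂ :* ((:- g₃) :* x :+ g₁ :* y)
      := detᴾ (matᴾ g₁ g₂ g₃ g₄) :* x) refl g₁ g₂ g₃ g₄ x y)
    (solve 6 (λ g₁ g₂ g₃ g₄ x y → g₃ :* (g₄ :* x :+ (:- g₂) :* y) :+ g₄ :* ((:- g₃) :* x :+ g₁ :* y)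
      := detᴾ (matᴾ g₁ g₂ g₃ g₄) :* y) refl g₁ g₂ g₃ g₄ x y)

  cross-act : ∀ G u v → cross (act G u) (act G v) ≡ det G * cross u v
  cross-act (mat g₁ g₂ g₃ g₄) (x , y) (x′ , y′) = solve 8 (λ g₁ g₂ g₃ g₄ x y x′ y′ →
      (g₁ :* x :+ g₂ :* y) :* (g₃ :* x′ :+ g₄ :* y′) :- (g₁ :* x′ :+ g₂ :* y′) :* (g₃ :* x :+ g₄ :* y)
      := detᴾ (matᴾ g₁ g₂ g₃ g₄) :* (x :* y′ :- x′ :* y)) refl g₁ g₂ g₃ g₄ x y x′ y′

  det*defect-conjugate : ∀ G M u → det G * defect (conjugate G M) u ≡ det G * defect M (act (adj G) u)
  det*defect-conjugate (mat g₁ g₂ g₃ g₄) (mat m₁ m₂ m₃ m₄) (x , y) = solve 10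
    (λ g₁ g₂ g₃ g₄ m₁ m₂ m₃ m₄ x y → let G = matᴾ g₁ g₂ g₃ g₄ ; M = matᴾ m₁ m₂ m₃ m₄ in
      detᴾ G :* defectᴾ (conjugateᴾ G M) x y
        := detᴾ G :* defectᴾ M (g₄ :* x :+ (:- g₂) :* y) ((:- g₃) :* x :+ g₁ :* y))
    refl g₁ g₂ g₃ g₄ m₁ m₂ m₃ m₄ x y

  defect-* : ∀ M x y k → defect M (x * k , y * k) ≡ (k * k) * defect M (x , y)
  defect-* (mat m₁ m₂ m₃ m₄) x y k = solve 7 (λ m₁ m₂ m₃ m₄ x y k → let M = matᴾ m₁ m₂ m₃ m₄ in
    defectᴾ M (x :* k) (y :* k) := (k :* k) :* defectᴾ M x y) refl m₁ m₂ m₃ m₄ x y k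

  c-adj⊗⊗ : ∀ G M → c ((adj G ⊗ M) ⊗ G) ≡ - defect M (a G , c G)
  c-adj⊗⊗ (mat g₁ g₂ g₃ g₄) (mat m₁ m₂ m₃ m₄) =
    solve 8 (onMat² λ G M → cᴾ ((adjᴾ G ⊗ᴾ M) ⊗ᴾ G) := :- defectᴾ M (aᴾ G) (cᴾ G)) refl g₁ g₂ g₃ g₄ m₁ m₂ m₃ m₄

  defect-upper-triangular : ∀ α β δ x y → defect (mat α β 0ℤ δ) (x , y) ≡ y * ((α - δ) * x + β * y)
  defect-upper-triangular α β δ x y = solve 5 (λ α β δ x y →
    defectᴾ (matᴾ α β (con 0ℤ) δ) x y := y :* ((α :- δ) :* x :+ β :* y)) refl α β δ x y

  defect-scalar-shear : ∀ α β x y → defect (mat α β 0ℤ α) (x , y) ≡ β * (y * y)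
  defect-scalar-shear α β x y = solve 4 (λ α β x y →
    defectᴾ (matᴾ α β (con 0ℤ) α) x y := β :* (y :* y)) refl α β x y

  cross-sum-left : ∀ x y x′ y′ → cross (x + x′ , y + y′) (x , y) ≡ - cross (x , y) (x′ , y′)
  cross-sum-left = solve 4 (λ x y x′ y′ →
    (x :+ x′) :* y :- x :* (y :+ y′) := :- (x :* y′ :- x′ :* y)) refl

  cross-sum-right : ∀ x y x′ y′ → cross (x + x′ , y + y′) (x′ , y′) ≡ cross (x , y) (x′ , y′)
  cross-sum-right = solve 4 (λ x y x′ y′ →
    (x :+ x′) :* y′ :- x′ :* (y :+ y′) := x :* y′ :- x′ :* y) refl

  cross-via-sum : ∀ x y x′ y′ → cross (x , y) (x′ , y′) ≡ x * (y + y′) - (x + x′) * y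
  cross-via-sum = solve 4 (λ x y x′ y′ →
    x :* y′ :- x′ :* y := x :* (y :+ y′) :- (x :+ x′) :* y) refl

scale-1 : ∀ M → scale 1ℤ M ≡ M
scale-1 (mat m₁ m₂ m₃ m₄) = mat-≡ (ℤₚ.*-identityˡ m₁) (ℤₚ.*-identityˡ m₂) (ℤₚ.*-identityˡ m₃) (ℤₚ.*-identityˡ m₄)

1*u≡u : ∀ (u : ℤ × ℤ) → (1ℤ * proj₁ u , 1ℤ * proj₂ u) ≡ u
1*u≡u (x , y) = cong₂ _,_ (ℤₚ.*-identityˡ x) (ℤₚ.*-identityˡ y)

Conj-trans : ∀ {L M N} → Conj L M → Conj M N → Conj L N
Conj-trans {L} (γ , γ∈SL2 , M≡) (δ , δ∈SL2 , N≡) =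
  δ ⊗ γ , trans (det-⊗ δ γ) (cong₂ _*_ δ∈SL2 γ∈SL2) ,
  trans N≡ (trans (cong (conjugate δ) M≡) (conjugate-conjugate δ γ L))

module _ (γ : Mat2) (γ∈SL2 : SL2 γ) where

  det-conjugate-SL2 : ∀ M → det (conjugate γ M) ≡ det M
  det-conjugate-SL2 M =
    trans (det-conjugate γ M) (trans (cong (λ g → (g * g) * det M) γ∈SL2) (ℤₚ.*-identityˡ (det M)))

  conjugate-adj-conjugate-SL2 : ∀ M → conjugate γ ((adj γ ⊗ M) ⊗ γ) ≡ M
  conjugate-adj-conjugate-SL2 M =
    trans (conjugate-adj-conjugate γ M) (trans (cong (λ g → scale (g * g) M) γ∈SL2) (scale-1 M))

  conjugate-⊗-SL2 : ∀ M → conjugate γ M ⊗ γ ≡ γ ⊗ M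
  conjugate-⊗-SL2 M = trans (conjugate-⊗ γ M) (trans (cong (λ g → scale g (γ ⊗ M)) γ∈SL2) (scale-1 (γ ⊗ M)))

  act-adj-act-SL2 : ∀ u → act (adj γ) (act γ u) ≡ u
  act-adj-act-SL2 u = trans (act-adj-act γ u) (trans (cong (λ g → (g * proj₁ u , g * proj₂ u)) γ∈SL2) (1*u≡u u))

  act-act-adj-SL2 : ∀ u → act γ (act (adj γ) u) ≡ u
  act-act-adj-SL2 u = trans (act-act-adj γ u) (trans (cong (λ g → (g * proj₁ u , g * proj₂ u)) γ∈SL2) (1*u≡u u))

  cross-act-adj-SL2 : ∀ u v → cross (act (adj γ) u) (act (adj γ) v) ≡ cross u v
  cross-act-adj-SL2 u v = trans (cross-act (adj γ) u v)
    (trans (cong (_* cross u v) (trans (det-adj γ) γ∈SL2)) (ℤₚ.*-identityˡ (cross u v)))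

  defect-conjugate-SL2 : ∀ M u → defect (conjugate γ M) u ≡ defect M (act (adj γ) u)
  defect-conjugate-SL2 M u = *-cancelˡ-≢0 (λ det≡0 → 1≢0 (trans (sym γ∈SL2) det≡0)) (det*defect-conjugate γ M u)
    where
    1≢0 : ¬ 1ℤ ≡ 0ℤ
    1≢0 ()

-- Fixed points

isFixed⇒defect≡0 : ∀ M {u} → IsFixed M u → defect M u ≡ 0ℤ
isFixed⇒defect≡0 M {x , y} (_ , fixed) =
  ℤₚ.i≡j⇒i-j≡0 (trans fixed (ℤₚ.*-comm (c M * x + d M * y) x))

defect≡0⇒isFixed : ∀ M {u} → NonZeroPt u → defect M u ≡ 0ℤ → IsFixed M u
defect≡0⇒isFixed M {x , y} u≢0 defect≡0 =
  u≢0 , trans (ℤₚ.i-j≡0⇒i≡j _ _ defect≡0) (ℤₚ.*-comm x (c M * x + d M * y))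

samePt⇒cross≡0 : ∀ u v → SamePt u v → cross u v ≡ 0ℤ
samePt⇒cross≡0 _ _ = ℤₚ.i≡j⇒i-j≡0

cross≡0⇒samePt : ∀ u v → cross u v ≡ 0ℤ → SamePt u v
cross≡0⇒samePt (x , y) (x′ , y′) = ℤₚ.i-j≡0⇒i≡j (x * y′) (x′ * y)

act-origin : ∀ G → act G (0ℤ , 0ℤ) ≡ (0ℤ , 0ℤ)
act-origin G = cong₂ _,_ (cong₂ _+_ (ℤₚ.*-zeroʳ (a G)) (ℤₚ.*-zeroʳ (b G)))
                         (cong₂ _+_ (ℤₚ.*-zeroʳ (c G)) (ℤₚ.*-zeroʳ (d G)))

nonZeroPt-act⁻¹ : ∀ G {u v} → act G v ≡ u → NonZeroPt u → NonZeroPt v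
nonZeroPt-act⁻¹ G {v = x , y} Gv≡u u≢0 (refl , refl) with trans (sym Gv≡u) (act-origin G)
... | refl = u≢0 (refl , refl)

module _ (γ : Mat2) (γ∈SL2 : SL2 γ) (M : Mat2) where

  isFixed-conjugate⁻¹ : ∀ {u} → IsFixed (conjugate γ M) u → IsFixed M (act (adj γ) u)
  isFixed-conjugate⁻¹ {u} fixed =
    defect≡0⇒isFixed M (nonZeroPt-act⁻¹ γ (act-act-adj-SL2 γ γ∈SL2 u) (proj₁ fixed))
      (trans (sym (defect-conjugate-SL2 γ γ∈SL2 M u)) (isFixed⇒defect≡0 (conjugate γ M) fixed))

  isFixed-conjugate : ∀ {u} → IsFixed M u → IsFixed (conjugate γ M) (act γ u)
  isFixed-conjugate {u} fixed =
    defect≡0⇒isFixed (conjugate γ M) (nonZeroPt-act⁻¹ (adj γ) (act-adj-act-SL2 γ γ∈SL2 u) (proj₁ fixed))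
      (trans (defect-conjugate-SL2 γ γ∈SL2 M (act γ u))
        (trans (cong (defect M) (act-adj-act-SL2 γ γ∈SL2 u)) (isFixed⇒defect≡0 M fixed)))

  hypCusp-conjugate⁻¹ : HypCusp (conjugate γ M) → HypCusp M
  hypCusp-conjugate⁻¹ (v , w , v-fixed , w-fixed , v≁w , only-v-w) =
    act (adj γ) v , act (adj γ) w , isFixed-conjugate⁻¹ v-fixed , isFixed-conjugate⁻¹ w-fixed ,
    (λ v∼w → v≁w (cross≡0⇒samePt v w
      (trans (sym (cross-act-adj-SL2 γ γ∈SL2 v w)) (samePt⇒cross≡0 (act (adj γ) v) (act (adj γ) w) v∼w)))) ,
    λ u u-fixed → pull-back u (only-v-w (act γ u) (isFixed-conjugate u-fixed))
    where
    pull-back-samePt : ∀ u z → SamePt (act γ u) z → SamePt u (act (adj γ) z)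
    pull-back-samePt u z γu∼z = cross≡0⇒samePt u (act (adj γ) z) (begin
      cross u (act (adj γ) z)
        ≡⟨ cong (λ p → cross p (act (adj γ) z)) (act-adj-act-SL2 γ γ∈SL2 u) ⟨
      cross (act (adj γ) (act γ u)) (act (adj γ) z)
        ≡⟨ cross-act-adj-SL2 γ γ∈SL2 (act γ u) z ⟩
      cross (act γ u) z
        ≡⟨ samePt⇒cross≡0 (act γ u) z γu∼z ⟩
      0ℤ ∎)
      where open ≡-Reasoning
    pull-back : ∀ u → SamePt (act γ u) v ⊎ SamePt (act γ u) w →
                SamePt u (act (adj γ) v) ⊎ SamePt u (act (adj γ) w)
    pull-back u (inj₁ γu∼v) = inj₁ (pull-back-samePt u v γu∼v)
    pull-back u (inj₂ γu∼w) = inj₂ (pull-back-samePt u w γu∼w)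

module _ (α β δ : ℤ) (α≢δ : ¬ α ≡ δ) where
  open +-*-Solver

  eigenvector-isFixed : IsFixed (mat α β 0ℤ δ) (β , δ - α)
  eigenvector-isFixed = defect≡0⇒isFixed (mat α β 0ℤ δ) (λ (_ , δ-α≡0) → α≢δ (sym (ℤₚ.i-j≡0⇒i≡j δ α δ-α≡0)))
    (trans (defect-upper-triangular α β δ β (δ - α))
      (solve 3 (λ α β δ → (δ :- α) :* ((α :- δ) :* β :+ β :* (δ :- α)) := con 0ℤ) refl α β δ))

  hypCusp-upper-triangular : HypCusp (mat α β 0ℤ δ)
  hypCusp-upper-triangular =
    (1ℤ , 0ℤ) , (β , δ - α) ,
    defect≡0⇒isFixed T (λ ()) (trans (defect-upper-triangular α β δ 1ℤ 0ℤ) (ℤₚ.*-zeroˡ ((α - δ) * 1ℤ + β * 0ℤ))) ,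
    eigenvector-isFixed ,
    (λ δ-α≡β*0 → α≢δ (sym (ℤₚ.i-j≡0⇒i≡j δ α (trans (sym (ℤₚ.*-identityˡ (δ - α))) (trans δ-α≡β*0 (ℤₚ.*-zeroʳ β)))))) ,
    only-two
    where
    T : Mat2
    T = mat α β 0ℤ δ
    cross-eigenvector : ∀ x y → cross (x , y) (β , δ - α) ≡ - ((α - δ) * x + β * y)
    cross-eigenvector x y = solve 5 (λ α β δ x y →
      x :* (δ :- α) :- β :* y := :- ((α :- δ) :* x :+ β :* y)) refl α β δ x y
    only-two : ∀ u → IsFixed T u → SamePt u (1ℤ , 0ℤ) ⊎ SamePt u (β , δ - α)
    only-two (x , y) fixed
      with ℤₚ.i*j≡0⇒i≡0∨j≡0 y (trans (sym (defect-upper-triangular α β δ x y)) (isFixed⇒defect≡0 T fixed))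
    ... | inj₁ refl  = inj₁ (trans (ℤₚ.*-zeroʳ x) (sym (ℤₚ.*-zeroʳ 1ℤ)))
    ... | inj₂ eigen = inj₂ (cross≡0⇒samePt (x , y) (β , δ - α) (trans (cross-eigenvector x y) (cong -_ eigen)))

-- A scalar matrix also fixes v + w; otherwise only the points (x : 0) are fixed.
¬hypCusp-scalar-shear : ∀ α β → ¬ HypCusp (mat α β 0ℤ α)
¬hypCusp-scalar-shear α β ((x , y) , (x′ , y′) , v-fixed , w-fixed , v≁w , only-v-w) with β ℤ.≟ 0ℤ
... | yes refl = [ v≁w ∘ sum≁v , v≁w ∘ sum≁w ] (only-v-w (x + x′ , y + y′) sum-fixed)
  where
  sum-fixed : IsFixed (mat α 0ℤ 0ℤ α) (x + x′ , y + y′)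
  sum-fixed = defect≡0⇒isFixed (mat α 0ℤ 0ℤ α)
    (λ (sx≡0 , sy≡0) → v≁w (cross≡0⇒samePt (x , y) (x′ , y′)
      (trans (cross-via-sum x y x′ y′)
        (trans (cong₂ (λ p q → x * q - p * y) sx≡0 sy≡0) (cong₂ _-_ (ℤₚ.*-zeroʳ x) (ℤₚ.*-zeroˡ y))))))
    (trans (defect-scalar-shear α 0ℤ (x + x′) (y + y′)) (ℤₚ.*-zeroˡ ((y + y′) * (y + y′))))
  sum≁v : SamePt (x + x′ , y + y′) (x , y) → SamePt (x , y) (x′ , y′)
  sum≁v s∼v = cross≡0⇒samePt (x , y) (x′ , y′)
    (ℤₚ.neg-injective (trans (sym (cross-sum-left x y x′ y′)) (samePt⇒cross≡0 (x + x′ , y + y′) (x , y) s∼v)))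
  sum≁w : SamePt (x + x′ , y + y′) (x′ , y′) → SamePt (x , y) (x′ , y′)
  sum≁w s∼w = cross≡0⇒samePt (x , y) (x′ , y′)
    (trans (sym (cross-sum-right x y x′ y′)) (samePt⇒cross≡0 (x + x′ , y + y′) (x′ , y′) s∼w))
... | no β≢0 = v≁w (subst₂ (λ p q → x * q ≡ x′ * p) (sym (y≡0 v-fixed)) (sym (y≡0 w-fixed))
                           (trans (ℤₚ.*-zeroʳ x) (sym (ℤₚ.*-zeroʳ x′))))
  where
  y≡0 : ∀ {u} → IsFixed (mat α β 0ℤ α) u → proj₂ u ≡ 0ℤ
  y≡0 {x , y} fixed = i*i≡0⇒i≡0 (k*i≡0⇒i≡0 β≢0
    (trans (sym (defect-scalar-shear α β x y)) (isFixed⇒defect≡0 (mat α β 0ℤ α) fixed)))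

-- Comparing entries of the triangular matrices in R′ γ = γ R forces
-- γ = ± (1 q ; 0 1), which shifts the upper right entry by ± q (D - A).
triangular-conjugate-offset : ∀ γ {s A X X′ D} → SL2 γ → IsSign s → ¬ A ≡ D →
  scale s (mat A X′ 0ℤ D) ≡ conjugate γ (scale s (mat A X 0ℤ D)) → Σ ℤ λ k → X′ ≡ X + k * (D - A)
triangular-conjugate-offset γ@(mat p q r t) {s} {A} {X} {X′} {D} γ∈SL2 σ A≢D conj≡ = p * q , X′≡
  where
  open +-*-Solver
  open ≡-Reasoning
  commute : scale s (mat A X′ 0ℤ D) ⊗ γ ≡ γ ⊗ scale s (mat A X 0ℤ D)
  commute = trans (cong (_⊗ γ) conj≡) (conjugate-⊗-SL2 γ γ∈SL2 (scale s (mat A X 0ℤ D)))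
  D-A≢0 : ¬ D - A ≡ 0ℤ
  D-A≢0 D-A≡0 = A≢D (sym (ℤₚ.i-j≡0⇒i≡j D A D-A≡0))
  r≡0 : r ≡ 0ℤ
  r≡0 = k*i≡0⇒i≡0 D-A≢0 (k*i≡0⇒i≡0 (sign≢0 σ) (begin
    s * ((D - A) * r)
      ≡⟨ solve 6 (λ s A D p r t → s :* ((D :- A) :* r)
           := ((s :* con 0ℤ) :* p :+ (s :* D) :* r) :- (r :* (s :* A) :+ t :* (s :* con 0ℤ))) refl s A D p r t ⟩
    c (scale s (mat A X′ 0ℤ D) ⊗ γ) - c (γ ⊗ scale s (mat A X 0ℤ D))
      ≡⟨ ℤₚ.i≡j⇒i-j≡0 (cong c commute) ⟩
    0ℤ ∎))
  p*t≡1 : p * t ≡ 1ℤ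
  p*t≡1 = trans (sym (det-upper-triangular p q t)) (subst (λ z → det (mat p q z t) ≡ 1ℤ) r≡0 γ∈SL2)
  p-sign : IsSign p
  p-sign = i*j≡1⇒sign p t p*t≡1
  t≡p : t ≡ p
  t≡p = *-cancelˡ-≢0 (sign≢0 p-sign) (trans p*t≡1 (sym (sign*sign≡1 p-sign)))
  upper-right : X′ * p - X * p - q * (D - A) ≡ 0ℤ
  upper-right = k*i≡0⇒i≡0 (sign≢0 σ) (begin
    s * (X′ * p - X * p - q * (D - A))
      ≡⟨ solve 7 (λ s A D X X′ p q → s :* (X′ :* p :- X :* p :- q :* (D :- A))
           := ((s :* A) :* q :+ (s :* X′) :* p) :- (p :* (s :* X) :+ q :* (s :* D))) refl s A D X X′ p q ⟩
    ((s * A) * q + (s * X′) * p) - (p * (s * X) + q * (s * D))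
      ≡⟨ cong (λ z → ((s * A) * q + (s * X′) * z) - (p * (s * X) + q * (s * D))) t≡p ⟨
    b (scale s (mat A X′ 0ℤ D) ⊗ γ) - b (γ ⊗ scale s (mat A X 0ℤ D))
      ≡⟨ ℤₚ.i≡j⇒i-j≡0 (cong b commute) ⟩
    0ℤ ∎)
  X′≡ : X′ ≡ X + p * q * (D - A)
  X′≡ = ℤₚ.i-j≡0⇒i≡j X′ (X + p * q * (D - A)) (begin
    X′ - (X + p * q * (D - A))
      ≡⟨ solve 6 (λ A D X X′ p q → X′ :- (X :+ p :* q :* (D :- A))
           := p :* (X′ :* p :- X :* p :- q :* (D :- A)) :+ (con 1ℤ :- p :* p) :* (X′ :- X)) refl A D X X′ p q ⟩
    p * (X′ * p - X * p - q * (D - A)) + (1ℤ - p * p) * (X′ - X)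
      ≡⟨ cong₂ (λ u w → p * u + (1ℤ - w) * (X′ - X)) upper-right (sign*sign≡1 p-sign) ⟩
    p * 0ℤ + (1ℤ - 1ℤ) * (X′ - X)
      ≡⟨ cong (_+ 0ℤ * (X′ - X)) (ℤₚ.*-zeroʳ p) ⟩
    0ℤ ∎)

infix 4 _∣ᴹ_
_∣ᴹ_ : ℤ → Mat2 → Set
k ∣ᴹ M = k ℤᵈ.∣ a M × k ℤᵈ.∣ b M × k ℤᵈ.∣ c M × k ℤᵈ.∣ d M

Primitive : Mat2 → Set
Primitive M = ∀ k → + k ∣ᴹ M → k ≡ 1

∣ᴹ-⊗ʳ : ∀ {k M} G → k ∣ᴹ M → k ∣ᴹ (G ⊗ M)
∣ᴹ-⊗ʳ G (k∣a , k∣b , k∣c , k∣d) =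
  ℤᵈ.∣m∣n⇒∣m+n (ℤᵈ.∣n⇒∣m*n (a G) k∣a) (ℤᵈ.∣n⇒∣m*n (b G) k∣c) ,
  ℤᵈ.∣m∣n⇒∣m+n (ℤᵈ.∣n⇒∣m*n (a G) k∣b) (ℤᵈ.∣n⇒∣m*n (b G) k∣d) ,
  ℤᵈ.∣m∣n⇒∣m+n (ℤᵈ.∣n⇒∣m*n (c G) k∣a) (ℤᵈ.∣n⇒∣m*n (d G) k∣c) ,
  ℤᵈ.∣m∣n⇒∣m+n (ℤᵈ.∣n⇒∣m*n (c G) k∣b) (ℤᵈ.∣n⇒∣m*n (d G) k∣d)

∣ᴹ-⊗ˡ : ∀ {k M} G → k ∣ᴹ M → k ∣ᴹ (M ⊗ G)
∣ᴹ-⊗ˡ G (k∣a , k∣b , k∣c , k∣d) =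
  ℤᵈ.∣m∣n⇒∣m+n (ℤᵈ.∣m⇒∣m*n (a G) k∣a) (ℤᵈ.∣m⇒∣m*n (c G) k∣b) ,
  ℤᵈ.∣m∣n⇒∣m+n (ℤᵈ.∣m⇒∣m*n (b G) k∣a) (ℤᵈ.∣m⇒∣m*n (d G) k∣b) ,
  ℤᵈ.∣m∣n⇒∣m+n (ℤᵈ.∣m⇒∣m*n (a G) k∣c) (ℤᵈ.∣m⇒∣m*n (c G) k∣d) ,
  ℤᵈ.∣m∣n⇒∣m+n (ℤᵈ.∣m⇒∣m*n (b G) k∣c) (ℤᵈ.∣m⇒∣m*n (d G) k∣d)

primitive-conjugate⁻¹ : ∀ {M N} γ → M ≡ conjugate γ N → Primitive M → Primitive N
primitive-conjugate⁻¹ γ refl M-primitive k k∣N = M-primitive k (∣ᴹ-⊗ˡ (adj γ) (∣ᴹ-⊗ʳ γ k∣N))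

InM⇒primitive : ∀ n {M} → InM n M → Primitive M
InM⇒primitive _ (_ , gcd≡1) k (k∣a , k∣b , k∣c , k∣d) = ℕ.∣1⇒≡1 (subst (k ℕ.∣_) (ℤₚ.+-injective gcd≡1)
  (ℕ.gcd-greatest (ℕ.gcd-greatest (ℤᵈ.∣⇒∣ᵤ k∣a) (ℤᵈ.∣⇒∣ᵤ k∣b)) (ℕ.gcd-greatest (ℤᵈ.∣⇒∣ᵤ k∣c) (ℤᵈ.∣⇒∣ᵤ k∣d))))

-- Triangularisation at a rational fixed point

bézout-+- : ∀ {g m n} x y → g ℕ.+ y ℕ.* n ≡ x ℕ.* m → + x * + m + - + y * + n ≡ + g
bézout-+- {g} {m} {n} x y eq = ℤₚ.i-j≡0⇒i≡j _ _ (begin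
  + x * + m + - + y * + n - + g
    ≡⟨ solve 5 (λ x y m n g → x :* m :+ (:- y) :* n :- g := x :* m :- (g :+ y :* n))
         refl (+ x) (+ y) (+ m) (+ n) (+ g) ⟩
  + x * + m - (+ g + + y * + n)
    ≡⟨ cong₂ (λ p q → p - (+ g + q)) (ℤₚ.pos-* x m) (ℤₚ.pos-* y n) ⟨
  + (x ℕ.* m) - + (g ℕ.+ y ℕ.* n)
    ≡⟨ ℤₚ.i≡j⇒i-j≡0 (cong +_ (sym eq)) ⟩
  0ℤ ∎)
  where open ≡-Reasoning; open +-*-Solver

ℤ-bezout : ∀ {g m n} → ℕ.Bézout.Identity g m n → Σ ℤ λ u → Σ ℤ λ v → u * + m + v * + n ≡ + g
ℤ-bezout (ℕ.Bézout.+- x y eq) = + x , - + y , bézout-+- x y eq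
ℤ-bezout {m = m} {n} (ℕ.Bézout.-+ x y eq) =
  - + x , + y , trans (ℤₚ.+-comm (- + x * + m) (+ y * + n)) (bézout-+- y x eq)

∣i∣≡sign*i : ∀ i → Σ ℤ λ s → + ∣ i ∣ ≡ s * i
∣i∣≡sign*i (+ n)    = 1ℤ  , sym (ℤₚ.*-identityˡ (+ n))
∣i∣≡sign*i -[1+ n ] = -1ℤ , sym (ℤₚ.-1*i≡-i -[1+ n ])

record PrimitiveMultiple (x y : ℤ) : Set where
  field
    g : ℕ
    0<g : 0 < g
    x′ y′ p q : ℤ
    x≡x′*g : x ≡ x′ * + g
    y≡y′*g : y ≡ y′ * + g
    bezout : p * x′ + q * y′ ≡ 1ℤ

primitiveMultiple : ∀ x y → NonZeroPt (x , y) → PrimitiveMultiple x y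
primitiveMultiple x y xy≢0 with ℕ.Bézout.lemma ∣ x ∣ ∣ y ∣
... | ℕ.Bézout.result g g-gcd g-bezout = record
  { g = g ; 0<g = ℕₚ.n≢0⇒n>0 g≢0 ; x′ = x′ ; y′ = y′ ; p = u * s ; q = v * t
  ; x≡x′*g = ℤᵈ._∣_.equality g∣x ; y≡y′*g = ℤᵈ._∣_.equality g∣y ; bezout = bezout }
  where
  g≢0 : ¬ g ≡ 0
  g≢0 refl = xy≢0 (ℤₚ.∣i∣≡0⇒i≡0 (ℕ.0∣⇒≡0 (ℕ.GCD.gcd∣m g-gcd)) , ℤₚ.∣i∣≡0⇒i≡0 (ℕ.0∣⇒≡0 (ℕ.GCD.gcd∣n g-gcd)))
  g∣x : + g ℤᵈ.∣ x
  g∣x = ℤᵈ.∣ᵤ⇒∣ (ℕ.GCD.gcd∣m g-gcd)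
  g∣y : + g ℤᵈ.∣ y
  g∣y = ℤᵈ.∣ᵤ⇒∣ (ℕ.GCD.gcd∣n g-gcd)
  x′ y′ : ℤ
  x′ = ℤᵈ._∣_.quotient g∣x
  y′ = ℤᵈ._∣_.quotient g∣y
  u v s t : ℤ
  u = proj₁ (ℤ-bezout g-bezout)
  v = proj₁ (proj₂ (ℤ-bezout g-bezout))
  s = proj₁ (∣i∣≡sign*i x)
  t = proj₁ (∣i∣≡sign*i y)
  bezout : u * s * x′ + v * t * y′ ≡ 1ℤ
  bezout = *-cancelˡ-≢0 (λ g≡0 → g≢0 (ℤₚ.+-injective g≡0)) (begin
    + g * (u * s * x′ + v * t * y′)
      ≡⟨ solve 7 (λ g u s x′ v t y′ →
           g :* (u :* s :* x′ :+ v :* t :* y′) := u :* (s :* (x′ :* g)) :+ v :* (t :* (y′ :* g)))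
         refl (+ g) u s x′ v t y′ ⟩
    u * (s * (x′ * + g)) + v * (t * (y′ * + g))
      ≡⟨ cong₂ (λ p q → u * (s * p) + v * (t * q)) (ℤᵈ._∣_.equality g∣x) (ℤᵈ._∣_.equality g∣y) ⟨
    u * (s * x) + v * (t * y)
      ≡⟨ cong₂ (λ p q → u * p + v * q) (proj₂ (∣i∣≡sign*i x)) (proj₂ (∣i∣≡sign*i y)) ⟨
    u * + ∣ x ∣ + v * + ∣ y ∣
      ≡⟨ proj₂ (proj₂ (ℤ-bezout g-bezout)) ⟩
    + g
      ≡⟨ ℤₚ.*-identityʳ (+ g) ⟨
    + g * 1ℤ ∎)
    where open ≡-Reasoning; open +-*-Solver

record Triangularisation (M : Mat2) (y : ℤ) : Set where
  field
    γ N : Mat2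
    γ∈SL2 : SL2 γ
    M≡γNγ⁻¹ : M ≡ conjugate γ N
    c≡0 : c N ≡ 0ℤ
    g : ℕ
    y≡c*g : y ≡ c γ * + g

-- Completing the primitive vector (x′ , y′) to the first column of γ ∈ SL(2,ℤ)
-- makes (1 , 0) a fixed point of γ⁻¹ M γ, i.e. kills its lower left entry.
triangularise : ∀ M {x y} → IsFixed M (x , y) → Triangularisation M y
triangularise M {x} {y} fixed = record
  { γ = γ ; N = (adj γ ⊗ M) ⊗ γ ; γ∈SL2 = γ∈SL2
  ; M≡γNγ⁻¹ = sym (conjugate-adj-conjugate-SL2 γ γ∈SL2 M)
  ; c≡0 = trans (c-adj⊗⊗ γ M) (cong -_ primitive-fixed)
  ; g = g ; y≡c*g = y≡y′*g }
  where
  open PrimitiveMultiple (primitiveMultiple x y (proj₁ fixed))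
  open +-*-Solver
  γ : Mat2
  γ = mat x′ (- q) y′ p
  γ∈SL2 : SL2 γ
  γ∈SL2 = trans (solve 4 (λ x′ y′ p q → x′ :* p :- (:- q) :* y′ := p :* x′ :+ q :* y′) refl x′ y′ p q) bezout
  g*g≢0 : ¬ + g * + g ≡ 0ℤ
  g*g≢0 g*g≡0 = ℕₚ.<⇒≢ 0<g (sym (ℤₚ.+-injective (i*i≡0⇒i≡0 g*g≡0)))
  primitive-fixed : defect M (x′ , y′) ≡ 0ℤ
  primitive-fixed = k*i≡0⇒i≡0 g*g≢0 (begin
    (+ g * + g) * defect M (x′ , y′) ≡⟨ defect-* M x′ y′ (+ g) ⟨
    defect M (x′ * + g , y′ * + g)   ≡⟨ cong₂ (λ p q → defect M (p , q)) x≡x′*g y≡y′*g ⟨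
    defect M (x , y)                 ≡⟨ isFixed⇒defect≡0 M fixed ⟩
    0ℤ                               ∎)
    where open ≡-Reasoning

-- The triangularisation at the second fixed point (β , δ - α) puts the
-- eigenvalue δ first.
swap-diagonal : ∀ α β δ → ¬ α ≡ δ → ¬ δ ≡ 0ℤ → Σ ℤ λ β′ → Conj (mat δ β′ 0ℤ α) (mat α β 0ℤ δ)
swap-diagonal α β δ α≢δ δ≢0 = b N , γ , γ∈SL2 , trans M≡γNγ⁻¹ (cong (conjugate γ) N≡)
  where
  T : Mat2
  T = mat α β 0ℤ δ
  open Triangularisation (triangularise T (eigenvector-isFixed α β δ α≢δ))
  open ≡-Reasoning
  open +-*-Solver
  cγ≢0 : ¬ c γ ≡ 0ℤ
  cγ≢0 cγ≡0 = α≢δ (sym (ℤₚ.i-j≡0⇒i≡j δ α (trans y≡c*g (trans (cong (_* + g) cγ≡0) (ℤₚ.*-zeroˡ (+ g))))))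
  aN≡δ : a N ≡ δ
  aN≡δ = *-cancelˡ-≢0 cγ≢0 (begin
    c γ * a N                   ≡⟨ solve 3 (λ x y z → x :* y := x :* y :+ z :* con 0ℤ) refl (c γ) (a N) (d γ) ⟩
    c γ * a N + d γ * 0ℤ        ≡⟨ cong (λ z → c γ * a N + d γ * z) c≡0 ⟨
    c (γ ⊗ N)                   ≡⟨ cong c (conjugate-⊗-SL2 γ γ∈SL2 N) ⟨
    c (conjugate γ N ⊗ γ)       ≡⟨ cong (λ M → c (M ⊗ γ)) M≡γNγ⁻¹ ⟨
    0ℤ * a γ + δ * c γ          ≡⟨ solve 3 (λ x y z → con 0ℤ :* x :+ y :* z := z :* y) refl (a γ) δ (c γ) ⟩
    c γ * δ                     ∎)
  dN≡α : d N ≡ α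
  dN≡α = *-cancelˡ-≢0 δ≢0 (begin
    δ * d N                     ≡⟨ cong (_* d N) aN≡δ ⟨
    a N * d N                   ≡⟨ det-upper-triangular (a N) (b N) (d N) ⟨
    det (mat (a N) (b N) 0ℤ (d N)) ≡⟨ cong det (upper-triangular-≡ N c≡0) ⟨
    det N                       ≡⟨ det-conjugate-SL2 γ γ∈SL2 N ⟨
    det (conjugate γ N)         ≡⟨ cong det M≡γNγ⁻¹ ⟨
    det T                       ≡⟨ det-upper-triangular α β δ ⟩
    α * δ                       ≡⟨ ℤₚ.*-comm α δ ⟩
    δ * α                       ∎)
  N≡ : N ≡ mat δ (b N) 0ℤ α
  N≡ = mat-≡ aN≡δ refl c≡0 dN≡α

record SignSplit (α δ : ℤ) (N : ℕ) : Set where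
  field
    s : ℤ
    s-sign : IsSign s
    a₀ d₀ : ℕ
    α≡s*a₀ : α ≡ s * + a₀
    δ≡s*d₀ : δ ≡ s * + d₀
    0<a₀ : 0 < a₀
    0<d₀ : 0 < d₀
    a₀*d₀≡N : a₀ ℕ.* d₀ ≡ N

signSplit : ∀ α δ {N} → 0 < N → α * δ ≡ + N → SignSplit α δ N
signSplit (+ suc i) (+ suc j) _ αδ≡N = record
  { s = 1ℤ ; s-sign = inj₁ refl ; a₀ = suc i ; d₀ = suc j
  ; α≡s*a₀ = sym (ℤₚ.*-identityˡ _) ; δ≡s*d₀ = sym (ℤₚ.*-identityˡ _) ; 0<a₀ = s≤s z≤n ; 0<d₀ = s≤s z≤n
  ; a₀*d₀≡N = ℤₚ.+-injective αδ≡N }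
signSplit -[1+ i ] -[1+ j ] _ αδ≡N = record
  { s = -1ℤ ; s-sign = inj₂ refl ; a₀ = suc i ; d₀ = suc j
  ; α≡s*a₀ = sym (ℤₚ.-1*i≡-i (+ suc i)) ; δ≡s*d₀ = sym (ℤₚ.-1*i≡-i (+ suc j)) ; 0<a₀ = s≤s z≤n ; 0<d₀ = s≤s z≤n
  ; a₀*d₀≡N = ℤₚ.+-injective αδ≡N }
signSplit (+ 0)     _         0<N refl = ⊥-elim (ℕₚ.<-irrefl refl 0<N)
signSplit α@(+ suc _) (+ 0) 0<N αδ≡N =
  ⊥-elim (ℕₚ.<⇒≢ 0<N (sym (ℤₚ.+-injective (trans (sym αδ≡N) (ℤₚ.*-zeroʳ α)))))
signSplit α@(-[1+ _ ]) (+ 0) 0<N αδ≡N =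
  ⊥-elim (ℕₚ.<⇒≢ 0<N (sym (ℤₚ.+-injective (trans (sym αδ≡N) (ℤₚ.*-zeroʳ α)))))
signSplit (+ suc i) -[1+ j ]  _ ()
signSplit -[1+ i ]  (+ suc j) _ ()

signedTriangular : ℤ → ℕ → ℤ → ℕ → Mat2
signedTriangular s a₀ β d₀ = mat (s * + a₀) β 0ℤ (s * + d₀)

record OrderedTriangularForm (n : ℕ) (M : Mat2) : Set where
  field
    s : ℤ
    s-sign : IsSign s
    a₀ d₀ : ℕ
    β : ℤ
    0<a₀ : 0 < a₀
    a₀<d₀ : a₀ < d₀
    a₀*d₀≡n*n : a₀ ℕ.* d₀ ≡ n ℕ.* n
    triangular-primitive : Primitive (signedTriangular s a₀ β d₀)
    triangular∼M : Conj (signedTriangular s a₀ β d₀) M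

orderDiagonal : ∀ {n M s a₀ d₀ β} → IsSign s → 0 < a₀ → 0 < d₀ → ¬ a₀ ≡ d₀ → a₀ ℕ.* d₀ ≡ n ℕ.* n →
  Primitive (signedTriangular s a₀ β d₀) → Conj (signedTriangular s a₀ β d₀) M → OrderedTriangularForm n M
orderDiagonal {s = s} {a₀} {d₀} {β} σ 0<a₀ 0<d₀ a₀≢d₀ a₀d₀≡n*n T-primitive T∼M with ℕₚ.<-cmp a₀ d₀
... | tri< a₀<d₀ _ _ = record
  { s = s ; s-sign = σ ; a₀ = a₀ ; d₀ = d₀ ; β = β ; 0<a₀ = 0<a₀ ; a₀<d₀ = a₀<d₀ ; a₀*d₀≡n*n = a₀d₀≡n*n
  ; triangular-primitive = T-primitive ; triangular∼M = T∼M }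
... | tri≈ _ a₀≡d₀ _ = ⊥-elim (a₀≢d₀ a₀≡d₀)
... | tri> _ _ d₀<a₀ = record
  { s = s ; s-sign = σ ; a₀ = d₀ ; d₀ = a₀ ; β = proj₁ swapped
  ; 0<a₀ = 0<d₀ ; a₀<d₀ = d₀<a₀ ; a₀*d₀≡n*n = trans (ℕₚ.*-comm d₀ a₀) a₀d₀≡n*n
  ; triangular-primitive = primitive-conjugate⁻¹ (proj₁ (proj₂ swapped)) (proj₂ (proj₂ (proj₂ swapped))) T-primitive
  ; triangular∼M = Conj-trans (proj₂ swapped) T∼M }
  where
  swapped : Σ ℤ λ β′ → Conj (signedTriangular s d₀ β′ a₀) (signedTriangular s a₀ β d₀)
  swapped = swap-diagonal (s * + a₀) β (s * + d₀)
    (λ sa₀≡sd₀ → a₀≢d₀ (ℤₚ.+-injective (*-cancelˡ-≢0 (sign≢0 σ) sa₀≡sd₀)))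
    (λ sd₀≡0 → ℕₚ.<⇒≢ 0<d₀ (sym (ℤₚ.+-injective (k*i≡0⇒i≡0 (sign≢0 σ) sd₀≡0))))

orderedTriangularForm : ∀ n M → 1 ≤ n → InM n M → HypCusp M → OrderedTriangularForm n M
orderedTriangularForm n M 1≤n M∈M M-hyp@(_ , _ , v-fixed , _) =
  orderDiagonal s-sign 0<a₀ 0<d₀ a₀≢d₀ a₀*d₀≡N T-primitive T∼M
  where
  open Triangularisation (triangularise M v-fixed)
  N≡ : N ≡ mat (a N) (b N) 0ℤ (d N)
  N≡ = upper-triangular-≡ N c≡0
  aN≢dN : ¬ a N ≡ d N
  aN≢dN aN≡dN = ¬hypCusp-scalar-shear (a N) (b N)
    (subst HypCusp (trans N≡ (cong (mat (a N) (b N) 0ℤ) (sym aN≡dN)))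
      (hypCusp-conjugate⁻¹ γ γ∈SL2 N (subst HypCusp M≡γNγ⁻¹ M-hyp)))
  det-N : a N * d N ≡ + (n ℕ.* n)
  det-N = begin
    a N * d N                       ≡⟨ det-upper-triangular (a N) (b N) (d N) ⟨
    det (mat (a N) (b N) 0ℤ (d N))  ≡⟨ cong det N≡ ⟨
    det N                           ≡⟨ det-conjugate-SL2 γ γ∈SL2 N ⟨
    det (conjugate γ N)             ≡⟨ cong det M≡γNγ⁻¹ ⟨
    det M                           ≡⟨ proj₁ M∈M ⟩
    + (n ℕ.* n)                     ∎
    where open ≡-Reasoning
  open SignSplit (signSplit (a N) (d N) (ℕₚ.*-mono-≤ 1≤n 1≤n) det-N)
  a₀≢d₀ : ¬ a₀ ≡ d₀
  a₀≢d₀ a₀≡d₀ = aN≢dN (trans α≡s*a₀ (trans (cong (λ m → s * + m) a₀≡d₀) (sym δ≡s*d₀)))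
  N≡T : N ≡ signedTriangular s a₀ (b N) d₀
  N≡T = mat-≡ α≡s*a₀ refl c≡0 δ≡s*d₀
  T-primitive : Primitive (signedTriangular s a₀ (b N) d₀)
  T-primitive = subst Primitive N≡T (primitive-conjugate⁻¹ γ M≡γNγ⁻¹ (InM⇒primitive n M∈M))
  T∼M : Conj (signedTriangular s a₀ (b N) d₀) M
  T∼M = subst (λ T → Conj T M) N≡T (γ , γ∈SL2 , M≡γNγ⁻¹)

-- Offsets modulo d - a

∣m∸n⇒m≡n : ∀ {h m n} → 1 ≤ n → n ≤ m → m ≤ h → h ℕ.∣ m ℕ.∸ n → m ≡ n
∣m∸n⇒m≡n {h} {m} {n} 1≤n n≤m m≤h h∣m∸n with m ℕ.∸ n ℕₚ.≟ 0
... | yes m∸n≡0 = trans (sym (ℕₚ.m∸n+n≡m n≤m)) (cong (ℕ._+ n) m∸n≡0)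
... | no m∸n≢0 = ⊥-elim (ℕₚ.<⇒≱ (ℕₚ.<-≤-trans (ℕₚ.∸-monoʳ-< {m} {n} {0} 1≤n n≤m) m≤h)
                    (ℕ.∣⇒≤ {{ℕ.≢-nonZero m∸n≢0}} h∣m∸n))

∣∣m-n∣⇒m≡n : ∀ {h m n} → 1 ≤ m → m ≤ h → 1 ≤ n → n ≤ h → h ℕ.∣ ∣ + m - + n ∣ → m ≡ n
∣∣m-n∣⇒m≡n {h} {m} {n} 1≤m m≤h 1≤n n≤h h∣m-n with ℕₚ.≤-total n m
... | inj₁ n≤m = ∣m∸n⇒m≡n 1≤n n≤m m≤h (subst (h ℕ.∣_) ∣m-n∣≡m∸n h∣m-n)
  where
  ∣m-n∣≡m∸n : ∣ + m - + n ∣ ≡ m ℕ.∸ n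
  ∣m-n∣≡m∸n = trans (cong ∣_∣ (ℤₚ.m-n≡m⊖n m n)) (trans (ℤₚ.∣m⊖n∣≡∣n⊖m∣ m n) (ℤₚ.∣⊖∣-≤ n≤m))
... | inj₂ m≤n = sym (∣m∸n⇒m≡n 1≤m m≤n n≤h (subst (h ℕ.∣_) ∣m-n∣≡n∸m h∣m-n))
  where
  ∣m-n∣≡n∸m : ∣ + m - + n ∣ ≡ n ℕ.∸ m
  ∣m-n∣≡n∸m = trans (cong ∣_∣ (ℤₚ.m-n≡m⊖n m n)) (ℤₚ.∣⊖∣-≤ m≤n)

record GcdCofactors (a d : ℕ) : Set where
  field
    α e : ℕ
    a≡α*h : a ≡ α ℕ.* ℕ.gcd a d
    d∸a≡e*h : d ℕ.∸ a ≡ e ℕ.* ℕ.gcd a d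
    0<e : 0 < e
    0<h : 0 < ℕ.gcd a d
    α⊥e : ℕ.Coprime α e

gcdCofactors : ∀ a d → 0 < a → a < d → GcdCofactors a d
gcdCofactors a d 0<a a<d = record
  { α = α ; e = δ ℕ.∸ α ; a≡α*h = a≡α*h ; d∸a≡e*h = d∸a≡e*h
  ; 0<e = ℕₚ.m<n⇒0<n∸m α<δ ; 0<h = ℕ.>-nonZero⁻¹ h ; α⊥e = α⊥e }
  where
  h : ℕ
  h = ℕ.gcd a d
  instance
    h≢0 : NonZero h
    h≢0 = ℕ.≢-nonZero (λ h≡0 → ℕₚ.<⇒≢ 0<a (sym (ℕ.gcd[m,n]≡0⇒m≡0 h≡0)))
  α δ : ℕ
  α = ℕ._∣_.quotient (ℕ.gcd[m,n]∣m a d)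
  δ = ℕ._∣_.quotient (ℕ.gcd[m,n]∣n a d)
  a≡α*h : a ≡ α ℕ.* h
  a≡α*h = ℕ._∣_.equality (ℕ.gcd[m,n]∣m a d)
  d≡δ*h : d ≡ δ ℕ.* h
  d≡δ*h = ℕ._∣_.equality (ℕ.gcd[m,n]∣n a d)
  d∸a≡e*h : d ℕ.∸ a ≡ (δ ℕ.∸ α) ℕ.* h
  d∸a≡e*h = trans (cong₂ ℕ._∸_ d≡δ*h a≡α*h) (sym (ℕₚ.*-distribʳ-∸ h δ α))
  α<δ : α < δ
  α<δ = ℕₚ.*-cancelʳ-< h α δ (subst₂ _<_ a≡α*h d≡δ*h a<d)
  α⊥δ : ℕ.Coprime α δ
  α⊥δ = ℕ.GCD≡1⇒coprime (ℕ.GCD-* (subst₂ (λ m n → ℕ.GCD m n (1 ℕ.* h)) a≡α*h d≡δ*h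
          (subst (ℕ.GCD a d) (sym (ℕₚ.*-identityˡ h)) (ℕ.gcd-GCD a d))))
  α⊥e : ℕ.Coprime α (δ ℕ.∸ α)
  α⊥e (i∣α , i∣e) = α⊥δ (i∣α , subst (_ ℕ.∣_) (ℕₚ.m∸n+n≡m (ℕₚ.<⇒≤ α<δ)) (ℕ.∣m∣n⇒∣m+n i∣e i∣α))

record InRange (a d b m : ℕ) : Set where
  field
    1≤b : 1 ≤ b
    b≤h : b ≤ ℕ.gcd a d
    1≤m : 1 ≤ m
    m*h≤d∸a : m ℕ.* ℕ.gcd a d ≤ d ℕ.∸ a

+m-+n≡+[m∸n] : ∀ {m n} → n ≤ m → + m - + n ≡ + (m ℕ.∸ n)
+m-+n≡+[m∸n] {m} {n} n≤m = trans (ℤₚ.m-n≡m⊖n m n) (ℤₚ.⊖-≥ n≤m)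

record ShiftedDivision (Y : ℤ) (h : ℕ) : Set where
  field
    r : ℕ
    j : ℤ
    r<h : r < h
    Y≡1+r+j*h : Y ≡ + suc r + j * + h

shifted-division : ∀ Y h .{{_ : NonZero h}} → ShiftedDivision Y h
shifted-division Y h = record { r = r ; j = j ; r<h = n%ℕd<d (Y - 1ℤ) h ; Y≡1+r+j*h = begin
  Y                         ≡⟨ solve 1 (λ Y → Y := (Y :- con 1ℤ) :+ con 1ℤ) refl Y ⟩
  (Y - 1ℤ) + 1ℤ             ≡⟨ cong (_+ 1ℤ) (a≡a%ℕn+[a/ℕn]*n (Y - 1ℤ) h) ⟩
  (+ r + j * + h) + 1ℤ      ≡⟨ solve 3 (λ r j h → (r :+ j :* h) :+ con 1ℤ := (con 1ℤ :+ r) :+ j :* h)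
                                 refl (+ r) j (+ h) ⟩
  (1ℤ + + r) + j * + h      ≡⟨ cong (_+ j * + h) (ℤₚ.pos-+ 1 r) ⟨
  + suc r + j * + h         ∎ }
  where
  open ≡-Reasoning
  open +-*-Solver
  r : ℕ
  r = (Y - 1ℤ) %ℕ h
  j : ℤ
  j = (Y - 1ℤ) /ℕ h

record Offset (a d : ℕ) (Y : ℤ) : Set where
  field
    b₀ m₀ : ℕ
    t : ℤ
    in-range : InRange a d b₀ m₀
    b₀+m₀a+t[d-a]≡Y : + (b₀ ℕ.+ m₀ ℕ.* a) + t * (+ d - + a) ≡ Y

module _ {a d : ℕ} (0<a : 0 < a) (a<d : a < d) where
  open GcdCofactors (gcdCofactors a d 0<a a<d)

  private
    h : ℕ
    h = ℕ.gcd a d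
    +a≡α*h : + a ≡ + α * + h
    +a≡α*h = trans (cong +_ a≡α*h) (ℤₚ.pos-* α h)
    d-a≡e*h : + d - + a ≡ + e * + h
    d-a≡e*h = trans (+m-+n≡+[m∸n] (ℕₚ.<⇒≤ a<d)) (trans (cong +_ d∸a≡e*h) (ℤₚ.pos-* e h))
    m≤e : ∀ {m} → m ℕ.* h ≤ d ℕ.∸ a → m ≤ e
    m≤e {m} m*h≤d∸a = ℕₚ.*-cancelʳ-≤ m e h {{ℕ.>-nonZero 0<h}} (subst (m ℕ.* h ≤_) d∸a≡e*h m*h≤d∸a)

  -- Modulo h the offset determines b; then (m′ - m) α ≡ k e with α coprime to e.
  offset-unique : ∀ {b m b′ m′} k → InRange a d b m → InRange a d b′ m′ →
                  + (b′ ℕ.+ m′ ℕ.* a) ≡ + (b ℕ.+ m ℕ.* a) + k * (+ d - + a) → b ≡ b′ × m ≡ m′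
  offset-unique {b} {m} {b′} {m′} k r r′ offset = b≡b′ , m≡m′
    where
    open InRange
    open +-*-Solver
    q : ℤ
    q = k * + e - (+ m′ - + m) * + α
    b′-b≡h*q : + b′ - + b ≡ + h * q
    b′-b≡h*q = ℤₚ.i-j≡0⇒i≡j _ _ (begin
      + b′ - + b - + h * q
        ≡⟨ solve 8 (λ b b′ m m′ k α e h → b′ :- b :- h :* (k :* e :- (m′ :- m) :* α)
                     := (b′ :+ m′ :* (α :* h)) :- (b :+ m :* (α :* h) :+ k :* (e :* h)))
                   refl (+ b) (+ b′) (+ m) (+ m′) k (+ α) (+ e) (+ h) ⟩
      (+ b′ + + m′ * (+ α * + h)) - (+ b + + m * (+ α * + h) + k * (+ e * + h))
        ≡⟨ cong₂ (λ x y → (+ b′ + + m′ * x) - (+ b + + m * x + k * y)) +a≡α*h d-a≡e*h ⟨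
      (+ b′ + + m′ * + a) - (+ b + + m * + a + k * (+ d - + a))
        ≡⟨ cong₂ (λ x y → (+ b′ + x) - (+ b + y + k * (+ d - + a))) (ℤₚ.pos-* m′ a) (ℤₚ.pos-* m a) ⟨
      + (b′ ℕ.+ m′ ℕ.* a) - (+ (b ℕ.+ m ℕ.* a) + k * (+ d - + a))
        ≡⟨ ℤₚ.i≡j⇒i-j≡0 offset ⟩
      0ℤ ∎)
      where open ≡-Reasoning
    b≡b′ : b ≡ b′
    b≡b′ = sym (∣∣m-n∣⇒m≡n (1≤b r′) (b≤h r′) (1≤b r) (b≤h r)
      (ℕ.divides ∣ q ∣ (trans (cong ∣_∣ b′-b≡h*q) (trans (ℤₚ.abs-* (+ h) q) (ℕₚ.*-comm h ∣ q ∣)))))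
    q≡0 : q ≡ 0ℤ
    q≡0 = k*i≡0⇒i≡0 (λ h≡0 → ℕₚ.<⇒≢ 0<h (sym (ℤₚ.+-injective h≡0)))
      (trans (sym b′-b≡h*q) (ℤₚ.i≡j⇒i-j≡0 (cong +_ (sym b≡b′))))
    e∣α*[m′-m] : e ℕ.∣ ∣ + α * (+ m′ - + m) ∣
    e∣α*[m′-m] = ℕ.divides ∣ k ∣ (trans (cong ∣_∣ α[m′-m]≡ke) (ℤₚ.abs-* k (+ e)))
      where
      α[m′-m]≡ke : + α * (+ m′ - + m) ≡ k * + e
      α[m′-m]≡ke = trans (ℤₚ.*-comm (+ α) (+ m′ - + m)) (sym (ℤₚ.i-j≡0⇒i≡j (k * + e) ((+ m′ - + m) * + α) q≡0))
    m≡m′ : m ≡ m′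
    m≡m′ = sym (∣∣m-n∣⇒m≡n (1≤m r′) (m≤e (m*h≤d∸a r′)) (1≤m r) (m≤e (m*h≤d∸a r))
      (ℤ.coprime-divisor (+ e) (+ α) (+ m′ - + m) (ℕ.sym α⊥e) e∣α*[m′-m]))

  -- Write Y = b + j h with 1 ≤ b ≤ h, then j = j (u α + v e) by Bézout and
  -- reduce j u modulo e to get m.
  offset-exists : ∀ Y → Offset a d Y
  offset-exists Y = record { b₀ = b₀ ; m₀ = m₀ ; t = t ; in-range = range ; b₀+m₀a+t[d-a]≡Y = begin
    + (b₀ ℕ.+ m₀ ℕ.* a) + t * (+ d - + a)
      ≡⟨ cong (_+ t * (+ d - + a)) (trans (ℤₚ.pos-+ b₀ (m₀ ℕ.* a)) (cong (λ x → + b₀ + x) (ℤₚ.pos-* m₀ a))) ⟩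
    + b₀ + + m₀ * + a + t * (+ d - + a)
      ≡⟨ cong₂ (λ x y → + b₀ + x * + a + t * y) m≡ju-t₂e d-a≡e*h ⟩
    + b₀ + (j * u - t₂ * + e) * + a + t * (+ e * + h)
      ≡⟨ cong (λ x → + b₀ + (j * u - t₂ * + e) * x + t * (+ e * + h)) +a≡α*h ⟩
    + b₀ + (j * u - t₂ * + e) * (+ α * + h) + (j * v + t₂ * + α) * (+ e * + h)
      ≡⟨ solve 8 (λ b j u v t₂ α e h →
           b :+ (j :* u :- t₂ :* e) :* (α :* h) :+ (j :* v :+ t₂ :* α) :* (e :* h)
             := b :+ j :* h :* (u :* α :+ v :* e))
         refl (+ b₀) j u v t₂ (+ α) (+ e) (+ h) ⟩
    + b₀ + j * + h * (u * + α + v * + e)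
      ≡⟨ cong (λ x → + b₀ + j * + h * x) uα+ve≡1 ⟩
    + b₀ + j * + h * 1ℤ
      ≡⟨ cong (λ x → + b₀ + x) (ℤₚ.*-identityʳ (j * + h)) ⟩
    + b₀ + j * + h
      ≡⟨ Y≡b+jh ⟨
    Y ∎ }
    where
    open ≡-Reasoning
    open +-*-Solver
    instance
      h≢0 : NonZero h
      h≢0 = ℕ.>-nonZero 0<h
      e≢0 : NonZero e
      e≢0 = ℕ.>-nonZero 0<e
    bézout : Σ ℤ λ u → Σ ℤ λ v → u * + α + v * + e ≡ 1ℤ
    bézout = ℤ-bezout (ℕ.coprime-Bézout α⊥e)
    u v : ℤ
    u = proj₁ bézout
    v = proj₁ (proj₂ bézout)
    uα+ve≡1 : u * + α + v * + e ≡ 1ℤ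
    uα+ve≡1 = proj₂ (proj₂ bézout)
    open ShiftedDivision (shifted-division Y h)
      using (j; r<h) renaming (r to r₁; Y≡1+r+j*h to Y≡b+jh)
    open ShiftedDivision (shifted-division (j * u) e)
      using () renaming (r to r₂; r<h to r₂<e; j to t₂; Y≡1+r+j*h to ju≡m+t₂e)
    b₀ m₀ : ℕ
    b₀ = suc r₁
    m₀ = suc r₂
    m≡ju-t₂e : + m₀ ≡ j * u - t₂ * + e
    m≡ju-t₂e = sym (trans (cong (_- t₂ * + e) ju≡m+t₂e) (solve 2 (λ m x → (m :+ x) :- x := m) refl (+ m₀) (t₂ * + e)))
    t : ℤ
    t = j * v + t₂ * + α
    range : InRange a d b₀ m₀
    range = record
      { 1≤b = s≤s z≤n ; b≤h = r<h ; 1≤m = s≤s z≤n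
      ; m*h≤d∸a = subst (m₀ ℕ.* h ≤_) (sym d∸a≡e*h) (ℕₚ.*-monoˡ-≤ h r₂<e) }

sum-product-injective : ∀ {a d a′ d′} → a < d → a′ < d′ →
                        a ℕ.+ d ≡ a′ ℕ.+ d′ → a ℕ.* d ≡ a′ ℕ.* d′ → a ≡ a′ × d ≡ d′
sum-product-injective {a} {d} {a′} {d′} a<d a′<d′ sum≡ product≡
  with ℤₚ.i*j≡0⇒i≡0∨j≡0 (+ a - + a′) root
  where
  open ≡-Reasoning
  open +-*-Solver
  root : (+ a - + a′) * (+ a - + d′) ≡ 0ℤ
  root = begin
    (+ a - + a′) * (+ a - + d′)
      ≡⟨ solve 3 (λ a a′ d′ → (a :- a′) :* (a :- d′) := a :* a :- a :* (a′ :+ d′) :+ a′ :* d′)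
           refl (+ a) (+ a′) (+ d′) ⟩
    + a * + a - + a * (+ a′ + + d′) + + a′ * + d′
      ≡⟨ cong₂ (λ x y → + a * + a - + a * x + y) (ℤₚ.pos-+ a′ d′) (ℤₚ.pos-* a′ d′) ⟨
    + a * + a - + a * + (a′ ℕ.+ d′) + + (a′ ℕ.* d′)
      ≡⟨ cong₂ (λ x y → + a * + a - + a * + x + + y) sum≡ product≡ ⟨
    + a * + a - + a * + (a ℕ.+ d) + + (a ℕ.* d)
      ≡⟨ cong₂ (λ x y → + a * + a - + a * x + y) (ℤₚ.pos-+ a d) (ℤₚ.pos-* a d) ⟩
    + a * + a - + a * (+ a + + d) + + a * + d
      ≡⟨ solve 2 (λ a d → a :* a :- a :* (a :+ d) :+ a :* d := con 0ℤ) refl (+ a) (+ d) ⟩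
    0ℤ ∎
... | inj₁ a-a′≡0 = a≡a′ , ℕₚ.+-cancelˡ-≡ a d d′ (trans sum≡ (cong (ℕ._+ d′) (sym a≡a′)))
  where
  a≡a′ : a ≡ a′
  a≡a′ = ℤₚ.+-injective (ℤₚ.i-j≡0⇒i≡j (+ a) (+ a′) a-a′≡0)
... | inj₂ a-d′≡0 = ⊥-elim (ℕₚ.<-asym a<d (subst₂ _<_ (sym d≡a′) (sym a≡d′) a′<d′))
  where
  a≡d′ : a ≡ d′
  a≡d′ = ℤₚ.+-injective (ℤₚ.i-j≡0⇒i≡j (+ a) (+ d′) a-d′≡0)
  d≡a′ : d ≡ a′
  d≡a′ = ℕₚ.+-cancelˡ-≡ a d a′ (trans sum≡ (trans (cong (a′ ℕ.+_) (sym a≡d′)) (ℕₚ.+-comm a′ a)))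

gcd[gcd[a,b+m*a],gcd[0,d]]≡1 : ∀ a d b m → ℕ.gcd b (ℕ.gcd a d) ≡ 1 →
                                ℕ.gcd (ℕ.gcd a (b ℕ.+ m ℕ.* a)) (ℕ.gcd 0 d) ≡ 1
gcd[gcd[a,b+m*a],gcd[0,d]]≡1 a d b m gcd≡1 =
  ℕ.∣1⇒≡1 (subst (g ℕ.∣_) gcd≡1 (ℕ.gcd-greatest g∣b (ℕ.gcd-greatest g∣a g∣d)))
  where
  g : ℕ
  g = ℕ.gcd (ℕ.gcd a (b ℕ.+ m ℕ.* a)) (ℕ.gcd 0 d)
  g∣a : g ℕ.∣ a
  g∣a = ℕ.∣-trans (ℕ.gcd[m,n]∣m _ (ℕ.gcd 0 d)) (ℕ.gcd[m,n]∣m a (b ℕ.+ m ℕ.* a))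
  g∣b+ma : g ℕ.∣ b ℕ.+ m ℕ.* a
  g∣b+ma = ℕ.∣-trans (ℕ.gcd[m,n]∣m _ (ℕ.gcd 0 d)) (ℕ.gcd[m,n]∣n a (b ℕ.+ m ℕ.* a))
  g∣d : g ℕ.∣ d
  g∣d = ℕ.∣-trans (ℕ.gcd[m,n]∣n (ℕ.gcd a (b ℕ.+ m ℕ.* a)) (ℕ.gcd 0 d)) (ℕ.gcd[m,n]∣n 0 d)
  g∣b : g ℕ.∣ b
  g∣b = ℕ.∣m+n∣m⇒∣n (subst (g ℕ.∣_) (ℕₚ.+-comm b (m ℕ.* a)) g∣b+ma) (ℕ.∣n⇒∣m*n m g∣a)

isRep⇒InM : ∀ n R → IsRep n R → InM n R
isRep⇒InM n _ (s , a , d , b , m , σ , a*d≡n*n , _ , _ , _ , _ , b⊥h , _ , _ , refl) = det≡ , gcd≡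
  where
  X : ℕ
  X = b ℕ.+ m ℕ.* a
  det≡ : det (scale s (mat (+ a) (+ X) 0ℤ (+ d))) ≡ + (n ℕ.* n)
  det≡ = begin
    det (scale s (mat (+ a) (+ X) 0ℤ (+ d))) ≡⟨ det-scale s (mat (+ a) (+ X) 0ℤ (+ d)) ⟩
    (s * s) * det (mat (+ a) (+ X) 0ℤ (+ d)) ≡⟨ cong₂ _*_ (sign*sign≡1 σ) (det-upper-triangular (+ a) (+ X) (+ d)) ⟩
    1ℤ * (+ a * + d)                         ≡⟨ ℤₚ.*-identityˡ (+ a * + d) ⟩
    + a * + d                                ≡⟨ ℤₚ.pos-* a d ⟨
    + (a ℕ.* d)                              ≡⟨ cong +_ a*d≡n*n ⟩
    + (n ℕ.* n)                              ∎
    where open ≡-Reasoning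
  gcd≡ : + ℕ.gcd (ℕ.gcd ∣ s * + a ∣ ∣ s * + X ∣) (ℕ.gcd ∣ s * 0ℤ ∣ ∣ s * + d ∣) ≡ 1ℤ
  gcd≡ rewrite ∣sign*i∣≡∣i∣ σ (+ a) | ∣sign*i∣≡∣i∣ σ (+ X) | ∣sign*i∣≡∣i∣ σ 0ℤ | ∣sign*i∣≡∣i∣ σ (+ d) =
    cong +_ (gcd[gcd[a,b+m*a],gcd[0,d]]≡1 a d b m b⊥h)

isRep⇒hypCusp : ∀ n R → IsRep n R → HypCusp R
isRep⇒hypCusp n _ (s , a , d , b , m , σ , _ , _ , a<d , _ , _ , _ , _ , _ , refl) =
  subst (λ z → HypCusp (mat (s * + a) (s * + X) z (s * + d))) (sym (ℤₚ.*-zeroʳ s))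
    (hypCusp-upper-triangular (s * + a) (s * + X) (s * + d)
      (λ sa≡sd → ℕₚ.<⇒≢ a<d (ℤₚ.+-injective (*-cancelˡ-≢0 (sign≢0 σ) sa≡sd))))
  where
  X : ℕ
  X = b ℕ.+ m ℕ.* a

representative : ∀ n {M} → OrderedTriangularForm n M → Σ Mat2 λ R → IsRep n R × Conj R M
representative n {M} F = R ,
  (s , a₀ , d₀ , b₀ , m₀ , s-sign , a₀*d₀≡n*n , 0<a₀ , a₀<d₀ , 1≤b , b≤h , b⊥h , 1≤m , m*h≤d∸a , refl) ,
  Conj-trans (mat 1ℤ t 0ℤ 1ℤ , det-upper-triangular 1ℤ t 1ℤ , T≡) triangular∼M
  where
  open OrderedTriangularForm F
  open Offset (offset-exists 0<a₀ a₀<d₀ (s * β)) renaming (b₀+m₀a+t[d-a]≡Y to X≡sβ)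
  open InRange in-range
  R : Mat2
  R = scale s (mat (+ a₀) (+ (b₀ ℕ.+ m₀ ℕ.* a₀)) 0ℤ (+ d₀))
  T≡ : signedTriangular s a₀ β d₀ ≡ conjugate (mat 1ℤ t 0ℤ 1ℤ) R
  T≡ = sym (trans (conjugate-translation t s (+ a₀) (+ (b₀ ℕ.+ m₀ ℕ.* a₀)) (+ d₀))
             (mat-≡ refl (trans (cong (s *_) X≡sβ) (sign*[sign*i]≡i s-sign β)) (ℤₚ.*-zeroʳ s) refl))
  k : ℕ
  k = ℕ.gcd b₀ (ℕ.gcd a₀ d₀)
  k∣a₀ : + k ℤᵈ.∣ + a₀
  k∣a₀ = ℤᵈ.∣ᵤ⇒∣ (ℕ.∣-trans (ℕ.gcd[m,n]∣n b₀ (ℕ.gcd a₀ d₀)) (ℕ.gcd[m,n]∣m a₀ d₀))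
  k∣d₀ : + k ℤᵈ.∣ + d₀
  k∣d₀ = ℤᵈ.∣ᵤ⇒∣ (ℕ.∣-trans (ℕ.gcd[m,n]∣n b₀ (ℕ.gcd a₀ d₀)) (ℕ.gcd[m,n]∣n a₀ d₀))
  k∣X : + k ℤᵈ.∣ + (b₀ ℕ.+ m₀ ℕ.* a₀)
  k∣X = ℤᵈ.∣ᵤ⇒∣ (ℕ.∣m∣n⇒∣m+n (ℕ.gcd[m,n]∣m b₀ (ℕ.gcd a₀ d₀)) (ℕ.∣n⇒∣m*n m₀ (ℤᵈ.∣⇒∣ᵤ k∣a₀)))
  k∣β : + k ℤᵈ.∣ β
  k∣β = subst (+ k ℤᵈ.∣_) (trans (cong (s *_) X≡sβ) (sign*[sign*i]≡i s-sign β))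
          (ℤᵈ.∣n⇒∣m*n s (ℤᵈ.∣m∣n⇒∣m+n k∣X (ℤᵈ.∣n⇒∣m*n t (ℤᵈ.∣m∣n⇒∣m-n k∣d₀ k∣a₀))))
  b⊥h : k ≡ 1
  b⊥h = triangular-primitive k (ℤᵈ.∣n⇒∣m*n s k∣a₀ , k∣β , ℤᵈ.divides 0ℤ refl , ℤᵈ.∣n⇒∣m*n s k∣d₀)

representative-unique : ∀ n R R′ → IsRep n R → IsRep n R′ → Conj R R′ → R ≡ R′
representative-unique n _ _
  (s  , a  , d  , b  , m  , σ  , ad≡  , 0<a  , a<d  , 1≤b  , b≤h  , _ , 1≤m  , mh≤  , refl)
  (s′ , a′ , d′ , b′ , m′ , σ′ , a′d′≡ , 0<a′ , a′<d′ , 1≤b′ , b≤h′ , _ , 1≤m′ , mh≤′ , refl)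
  (γ , γ∈SL2 , R′≡γRγ⁻¹) = same-invariants (proj₁ signs) (proj₁ diagonals) (proj₂ diagonals)
  where
  R : Mat2
  R = scale s (mat (+ a) (+ (b ℕ.+ m ℕ.* a)) 0ℤ (+ d))
  trace≡ : s * + (a ℕ.+ d) ≡ s′ * + (a′ ℕ.+ d′)
  trace≡ = begin
    s * + (a ℕ.+ d)                 ≡⟨ trans (cong (s *_) (ℤₚ.pos-+ a d)) (ℤₚ.*-distribˡ-+ s (+ a) (+ d)) ⟩
    s * + a + s * + d               ≡⟨ ℤₚ.*-identityˡ (s * + a + s * + d) ⟨
    1ℤ * (s * + a + s * + d)        ≡⟨ cong (_* (s * + a + s * + d)) γ∈SL2 ⟨
    det γ * (Mat2.a R + Mat2.d R)   ≡⟨ trace-conjugate γ R ⟨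
    Mat2.a (conjugate γ R) + Mat2.d (conjugate γ R) ≡⟨ cong (λ M → Mat2.a M + Mat2.d M) R′≡γRγ⁻¹ ⟨
    s′ * + a′ + s′ * + d′           ≡⟨ trans (cong (s′ *_) (ℤₚ.pos-+ a′ d′)) (ℤₚ.*-distribˡ-+ s′ (+ a′) (+ d′)) ⟨
    s′ * + (a′ ℕ.+ d′)              ∎
    where open ≡-Reasoning
  signs : s ≡ s′ × a ℕ.+ d ≡ a′ ℕ.+ d′
  signs = sign*+-injective σ σ′ (ℕₚ.<-≤-trans 0<a (ℕₚ.m≤m+n a d)) (ℕₚ.<-≤-trans 0<a′ (ℕₚ.m≤m+n a′ d′)) trace≡
  diagonals : a ≡ a′ × d ≡ d′
  diagonals = sum-product-injective a<d a′<d′ (proj₂ signs) (trans ad≡ (sym a′d′≡))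
  same-invariants : s ≡ s′ → a ≡ a′ → d ≡ d′ →
    R ≡ scale s′ (mat (+ a′) (+ (b′ ℕ.+ m′ ℕ.* a′)) 0ℤ (+ d′))
  same-invariants refl refl refl =
    cong₂ (λ b m → scale s (mat (+ a) (+ (b ℕ.+ m ℕ.* a)) 0ℤ (+ d))) (proj₁ b,m≡) (proj₂ b,m≡)
    where
    offset : Σ ℤ λ k → + (b′ ℕ.+ m′ ℕ.* a) ≡ + (b ℕ.+ m ℕ.* a) + k * (+ d - + a)
    offset = triangular-conjugate-offset γ γ∈SL2 σ (λ +a≡+d → ℕₚ.<⇒≢ a<d (ℤₚ.+-injective +a≡+d)) R′≡γRγ⁻¹
    b,m≡ : b ≡ b′ × m ≡ m′
    b,m≡ = offset-unique 0<a a<d (proj₁ offset)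
      (record { 1≤b = 1≤b ; b≤h = b≤h ; 1≤m = 1≤m ; m*h≤d∸a = mh≤ })
      (record { 1≤b = 1≤b′ ; b≤h = b≤h′ ; 1≤m = 1≤m′ ; m*h≤d∸a = mh≤′ }) (proj₂ offset)

mainTheorem10 : (n : ℕ) → 1 ≤ n →
    ((M : Mat2) → IsRep n M → InM n M × HypCusp M)
    × ((M : Mat2) → InM n M → HypCusp M → Σ Mat2 λ R → IsRep n R × Conj R M)
    × ((R R' : Mat2) → IsRep n R → IsRep n R' → Conj R R' → R ≡ R')
mainTheorem10 n 1≤n =
  (λ R R-rep → isRep⇒InM n R R-rep , isRep⇒hypCusp n R R-rep) ,
  (λ M M∈M M-hyp → representative n (orderedTriangularForm n M 1≤n M∈M M-hyp)) ,
  representative-unique n
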